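{- Let $(\mathcal{S}_n)_{n\ge1}$ be the Sierpiński gasket graphs, and for $k\in\{0,1,2,3\}$ let $\alpha_n^k$ denote the largest cardinality of an independent set of $\mathcal{S}_n$ containing exactly $k$ of the three outmost vertices. Then for every $n\geq 2$, $$\alpha_n^0+1=\alpha_n^1=\alpha_n^2=\alpha_n^3-1.$$
   Context: The Sierpiński gasket graphs $\mathcal{S}_n$, each with three distinguished "outmost" vertices $A_n,B_n,C_n$, are defined recursively: $\mathcal{S}_1$ is a triangle with vertices $A_1,B_1,C_1$. Given $\mathcal{S}_n$, take three disjoint copies $\mathcal{S}_n^{(1)},\mathcal{S}_n^{(2)},\mathcal{S}_n^{(3)}$ with outmost vertices $A_n^{(\theta)},B_n^{(\theta)},C_n^{(\theta)}$; identify $B_n^{(1)}$ with $A_n^{(2)}$, $C_n^{(1)}$ with $A_n^{(3)}$, and $C_n^{(2)}$ with $B_n^{(3)}$; the result is $\mathcal{S}_{n+1}$, with outmost vertices $A_{n+1}=A_n^{(1)}$, $B_{n+1}=B_n^{(2)}$, $C_{n+1}=C_n^{(3)}$. An independent set is a set of pairwise non-adjacent vertices. -}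

module Defs where

open import Data.Nat using (ℕ; zero; suc; _+_; _*_; _≡ᵇ_)
open import Data.Nat.Properties using (_≟_)
open import Data.Bool using (if_then_else_)
open import Data.List using (List; []; _∷_; map; _++_; length; filter)
open import Data.List.Membership.Propositional using (_∈_)
open import Data.List.Membership.DecPropositional _≟_ using (_∈?_)
open import Data.List.Relation.Unary.All using (All)
open import Data.List.Relation.Unary.Unique.Propositional using (Unique)
open import Data.Product using (_×_; _,_; Σ; ∃)
open import Data.Sum using (_⊎_)
open import Relation.Nullary using (¬_)
open import Relation.Binary.PropositionalEquality using (_≡_)

-- A finite graph with vertices labelled by natural numbers and three
-- distinguished (outmost) vertices A, B, C.  The vertex set is the set of
-- labels occurring in 'verts' (duplicates are irrelevant); edges are
-- undirected (see 'Adj').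
record Graph : Set where
  constructor mkGraph
  field
    verts : List ℕ
    edges : List (ℕ × ℕ)
    A B C : ℕ
open Graph public

IsVertex : Graph → ℕ → Set
IsVertex G x = x ∈ verts G

Adj : Graph → ℕ → ℕ → Set
Adj G x y = ((x , y) ∈ edges G) ⊎ ((y , x) ∈ edges G)

triangle : Graph
triangle = mkGraph (0 ∷ 1 ∷ 2 ∷ [])
                   ((0 , 1) ∷ (1 , 2) ∷ (0 , 2) ∷ []) 0 1 2

mapEdge : (ℕ → ℕ) → ℕ × ℕ → ℕ × ℕ
mapEdge f (x , y) = (f x , f y)

-- Copy 2 : v ↦ 3v+1,
-- except A ↦ 3B (= copy-1 image of B), realising B⁽¹⁾ = A⁽²⁾.  Copy 3 :
-- v ↦ 3v+2, except A ↦ 3C (C⁽¹⁾ = A⁽³⁾) and B ↦ copy-2 image of C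
-- (C⁽²⁾ = B⁽³⁾).  All other labels of different copies are distinct
-- (different residues mod 3), so exactly the prescribed identifications occur.
copy1 : Graph → ℕ → ℕ
copy1 G v = 3 * v

copy2 : Graph → ℕ → ℕ
copy2 G v = if v ≡ᵇ A G then 3 * B G else 3 * v + 1

copy3 : Graph → ℕ → ℕ
copy3 G v = if v ≡ᵇ A G then 3 * C G
            else (if v ≡ᵇ B G then copy2 G (C G) else 3 * v + 2)

step : Graph → Graph
step G = mkGraph
  (map (copy1 G) (verts G) ++ map (copy2 G) (verts G) ++ map (copy3 G) (verts G))
  (map (mapEdge (copy1 G)) (edges G) ++ map (mapEdge (copy2 G)) (edges G)
     ++ map (mapEdge (copy3 G)) (edges G))
  (copy1 G (A G)) (copy2 G (B G)) (copy3 G (C G))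

-- 𝒮 n is the Sierpiński gasket graph S_n for n ≥ 1.
-- (𝒮 0 is an unused placeholder, set to the triangle.)
𝒮 : ℕ → Graph
𝒮 zero = triangle
𝒮 (suc zero) = triangle
𝒮 (suc (suc n)) = step (𝒮 (suc n))

record IndependentSet (G : Graph) (I : List ℕ) : Set where
  field
    unique   : Unique I
    inVerts  : All (IsVertex G) I
    nonAdj   : ∀ {x y} → x ∈ I → y ∈ I → ¬ Adj G x y

outmostCount : Graph → List ℕ → ℕ
outmostCount G I = length (filter (_∈? I) (A G ∷ B G ∷ C G ∷ []))

IsAlpha : Graph → ℕ → ℕ → Set
IsAlpha G k m =
  (Σ (List ℕ) λ I → IndependentSet G I × outmostCount G I ≡ k × length I ≡ m)
  × (∀ I → IndependentSet G I → outmostCount G I ≡ k → length I Data.Nat.≤ m)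

{-# OPTIONS --safe #-}
-- Record, for each outmost pattern p ∈ {0,1}³, the largest size of an independent set of 𝒮 n with
-- pattern p.  An independent set of 𝒮 (n+1) restricts to independent sets of its three copies of 𝒮 n
-- that agree at the three junction vertices, and conversely three such sets glue together; counting
-- the junction vertices twice gives |I| + #(chosen junctions) = Σ |I ∩ copy|.  Hence the sizes obey a
-- max-plus recurrence over the junction pattern, and a finite check shows that sizes of the form
-- m + bonus |p| (bonus = 0, 1, 1, 2) reproduce themselves with m ↦ 3m + 1.  The induction starts from
-- the triangle, whose sizes have the same form with m = 0 on the patterns with at most one corner.
module Submission where

open import Defs
open import Data.Nat using (ℕ; _+_; _≤_)
open import Data.Product using (_×_; ∃)

open import Data.Nat using (zero; suc; _*_; _<_; _≡ᵇ_; _≤ᵇ_; _%_; z≤n; s≤s)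
open import Data.Nat.Properties
  using (_≟_; ≤ᵇ⇒≤; ≡ᵇ⇒≡; ≤-reflexive; +-mono-≤; +-monoʳ-≤; +-cancelʳ-≤; +-cancelʳ-≡; +-cancelˡ-≡
        ; +-assoc; +-comm; +-identityʳ; *-comm; *-cancelʳ-≡; module ≤-Reasoning)
open import Data.Nat.DivMod using ([m+kn]%n≡m%n; m<n⇒m%n≡m)
open import Data.Nat.Solver using (module +-*-Solver)
open import Data.Bool using (Bool; true; false; T; if_then_else_)
open import Data.Unit using (tt)
open import Data.Empty using (⊥-elim)
open import Data.Product using (Σ; ∃₂; _,_; proj₁; proj₂; uncurry)
open import Data.Sum using (inj₁; inj₂; [_,_]′)
open import Data.List using (List; []; _∷_; _++_; map; filter; length; cartesianProduct; deduplicate)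
open import Data.List.Properties using (map-++; map-∘; map-cong-local)
open import Data.Nat.ListAction using (sum)
open import Data.Bool.ListAction using (all)
open import Data.Nat.ListAction.Properties using (sum-++)
open import Data.List.Membership.Propositional using (_∈_; _∉_)
open import Data.List.Membership.Propositional.Properties
  using ( ∈-map⁺; ∈-map⁻; ∈-++⁺ˡ; ∈-++⁺ʳ; ∈-++⁻; ∈-filter⁺; ∈-filter⁻; ∈-cartesianProduct⁺
        ; deduplicate-∈⇔)
open import Data.List.Membership.Propositional.Properties.WithK using (unique∧set⇒bag)
open import Data.List.Membership.DecPropositional _≟_ using (_∈?_)
open import Data.List.Relation.Unary.Any using (here; there)
open import Data.List.Relation.Unary.All as All using (All; []; _∷_)
open import Data.List.Relation.Unary.All.Properties using (all⁺; All¬⇒¬Any; ¬Any⇒All¬)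
open import Data.List.Relation.Unary.AllPairs using ([]; _∷_)
open import Data.List.Relation.Unary.Unique.Propositional using (Unique)
open import Data.List.Relation.Unary.Unique.Propositional.Properties using (map⁺; ++⁺; filter⁺)
open import Data.List.Relation.Unary.Unique.DecPropositional.Properties _≟_ using (deduplicate-!)
open import Data.List.Relation.Binary.BagAndSetEquality using (∼bag⇒↭; _∼[_]_; set)
open import Data.List.Relation.Binary.Permutation.Propositional.Properties using (↭-length)
open import Function using (_∘_; _⇔_; mk⇔; Equivalence)
open import Function.Properties.Equivalence using () renaming (refl to ⇔-refl)
open import Relation.Nullary using (¬_; yes; no; does)
open import Relation.Nullary.Decidable using (dec-true; dec-false)
open import Relation.Unary using (Decidable)
open import Relation.Binary.PropositionalEquality
  using (_≡_; _≢_; refl; sym; trans; cong; cong₂; subst; module ≡-Reasoning)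

open Equivalence using (to; from)

bit : Bool → ℕ
bit false = 0
bit true  = 1

_∈ᵇ_ : ℕ → List ℕ → Bool
w ∈ᵇ I = does (w ∈? I)

count : (ℕ → Bool) → List ℕ → ℕ
count t xs = sum (map (bit ∘ t) xs)

count-++ : ∀ t xs ys → count t (xs ++ ys) ≡ count t xs + count t ys
count-++ t xs ys = trans (cong sum (map-++ (bit ∘ t) xs ys)) (sum-++ (map (bit ∘ t) xs) _)

count-map : ∀ t (f : ℕ → ℕ) xs → count t (map f xs) ≡ count (t ∘ f) xs
count-map t f xs = cong sum (sym (map-∘ xs))

count-cong : ∀ {s t} xs → (∀ {x} → x ∈ xs → s x ≡ t x) → count s xs ≡ count t xs
count-cong xs eq = cong sum (map-cong-local (All.tabulate (cong bit ∘ eq)))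

length-filter≡count : ∀ {P : ℕ → Set} (P? : Decidable P) xs → length (filter P? xs) ≡ count (does ∘ P?) xs
length-filter≡count P? [] = refl
length-filter≡count P? (x ∷ xs) with does (P? x)
... | true  = cong suc (length-filter≡count P? xs)
... | false = length-filter≡count P? xs

length-cong-set : ∀ {xs ys : List ℕ} → Unique xs → Unique ys → xs ∼[ set ] ys → length xs ≡ length ys
length-cong-set uxs uys xs≈ys = ↭-length (∼bag⇒↭ (unique∧set⇒bag uxs uys xs≈ys))

length≡count-∈ᵇ : ∀ {I V} → Unique I → Unique V → (∀ {w} → w ∈ I → w ∈ V) → length I ≡ count (_∈ᵇ I) V
length≡count-∈ᵇ {I} {V} uI uV I⊆V =
  trans (length-cong-set uI (filter⁺ (_∈? I) uV) I≈filter) (length-filter≡count (_∈? I) V)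
  where
  I≈filter : I ∼[ set ] filter (_∈? I) V
  I≈filter = mk⇔ (λ w∈I → ∈-filter⁺ (_∈? I) (I⊆V w∈I) w∈I) (proj₂ ∘ ∈-filter⁻ (_∈? I) {xs = V})

∈ᵇ-cong : ∀ {u w X Y} → (u ∈ X ⇔ w ∈ Y) → u ∈ᵇ X ≡ w ∈ᵇ Y
∈ᵇ-cong {u} {w} {X} {Y} u∈X⇔w∈Y with u ∈? X
... | yes u∈X = sym (dec-true (w ∈? Y) (to u∈X⇔w∈Y u∈X))
... | no u∉X  = sym (dec-false (w ∈? Y) (u∉X ∘ from u∈X⇔w∈Y))

∈ᵇ-≡⇒⇔ : ∀ {u w X Y} → u ∈ᵇ X ≡ w ∈ᵇ Y → (u ∈ X ⇔ w ∈ Y)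
∈ᵇ-≡⇒⇔ {u} {w} {X} {Y} eq with u ∈? X | w ∈? Y
... | yes u∈X | yes w∈Y = mk⇔ (λ _ → w∈Y) (λ _ → u∈X)
... | no u∉X  | no w∉Y  = mk⇔ (⊥-elim ∘ u∉X) (⊥-elim ∘ w∉Y)
... | yes _   | no _    with () ← eq
... | no _    | yes _   with () ← eq

Pattern : Set
Pattern = Bool × Bool × Bool

weight : Pattern → ℕ
weight (a , b , c) = bit a + bit b + bit c

outmost : Graph → List ℕ → Pattern
outmost G I = A G ∈ᵇ I , B G ∈ᵇ I , C G ∈ᵇ I

pattern-≡ : ∀ {a b c a′ b′ c′ : Bool} → a ≡ a′ → b ≡ b′ → c ≡ c′ → (a , b , c) ≡ (a′ , b′ , c′)
pattern-≡ refl refl refl = refl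

count-outmost : ∀ G I → count (_∈ᵇ I) (A G ∷ B G ∷ C G ∷ []) ≡ weight (outmost G I)
count-outmost G I = begin
  bit a + (bit b + (bit c + 0))      ≡⟨ cong (λ n → bit a + (bit b + n)) (+-identityʳ (bit c)) ⟩
  bit a + (bit b + bit c)            ≡⟨ sym (+-assoc (bit a) (bit b) (bit c)) ⟩
  weight (outmost G I)               ∎
  where
  open ≡-Reasoning
  a b c : Bool
  a = A G ∈ᵇ I
  b = B G ∈ᵇ I
  c = C G ∈ᵇ I

outmostCount≡weight : ∀ G I → outmostCount G I ≡ weight (outmost G I)
outmostCount≡weight G I = trans (length-filter≡count (_∈? I) (A G ∷ B G ∷ C G ∷ [])) (count-outmost G I)

allPatterns : List Pattern
allPatterns = cartesianProduct bools (cartesianProduct bools bools)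
  where
  bools : List Bool
  bools = false ∷ true ∷ []

∈-allPatterns : ∀ p → p ∈ allPatterns
∈-allPatterns (a , b , c) = ∈-cartesianProduct⁺ (∈-bools a) (∈-cartesianProduct⁺ (∈-bools b) (∈-bools c))
  where
  ∈-bools : ∀ x → x ∈ false ∷ true ∷ []
  ∈-bools false = here refl
  ∈-bools true  = there (here refl)

decide : (f : Pattern → Bool) → T (all f allPatterns) → ∀ p → T (f p)
decide f checked p = All.lookup (all⁺ f allPatterns checked) (∈-allPatterns p)

decide₂ : (f : Pattern → Pattern → Bool) → T (all (λ p → all (f p) allPatterns) allPatterns) → ∀ p q → T (f p q)
decide₂ f checked p = decide (f p) (decide (λ p → all (f p) allPatterns) checked p)

data Copy : Set where
  c₁ c₂ c₃ : Copy

Σᶜ : (Copy → ℕ) → ℕ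
Σᶜ f = f c₁ + f c₂ + f c₃

Σᶜ-cong : ∀ {f g} → (∀ r → f r ≡ g r) → Σᶜ f ≡ Σᶜ g
Σᶜ-cong f≡g = cong₂ _+_ (cong₂ _+_ (f≡g c₁) (f≡g c₂)) (f≡g c₃)

Σᶜ-mono-≤ : ∀ {f g} → (∀ r → f r ≤ g r) → Σᶜ f ≤ Σᶜ g
Σᶜ-mono-≤ f≤g = +-mono-≤ (+-mono-≤ (f≤g c₁) (f≤g c₂)) (f≤g c₃)

-- q is the pattern of the junction vertices B⁽¹⁾ = A⁽²⁾, C⁽¹⁾ = A⁽³⁾, C⁽²⁾ = B⁽³⁾.
copyPattern : Copy → Pattern → Pattern → Pattern
copyPattern c₁ (a , b , c) (x , y , z) = a , x , y
copyPattern c₂ (a , b , c) (x , y , z) = x , b , z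
copyPattern c₃ (a , b , c) (x , y , z) = y , z , c

copyPattern-injective : ∀ {p q p′ q′} → (∀ r → copyPattern r p q ≡ copyPattern r p′ q′) → p ≡ p′ × q ≡ q′
copyPattern-injective {_ , _ , _} {_ , _ , _} {_ , _ , _} {_ , _ , _} eq
  with eq c₁ | eq c₂ | eq c₃
... | refl | refl | refl = refl , refl

outmost-cong : ∀ G {X Y} → X ∼[ set ] Y → outmost G X ≡ outmost G Y
outmost-cong G X≈Y = pattern-≡ (∈ᵇ-cong X≈Y) (∈ᵇ-cong X≈Y) (∈ᵇ-cong X≈Y)

copies : {X Y : Set} → (Copy → X → Y) → (Copy → List X) → List Y
copies f xs = map (f c₁) (xs c₁) ++ map (f c₂) (xs c₂) ++ map (f c₃) (xs c₃)

module _ {X Y : Set} {f : Copy → X → Y} {xs : Copy → List X} where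

  ∈-copies⁺ : ∀ r {x} → x ∈ xs r → f r x ∈ copies f xs
  ∈-copies⁺ c₁ x∈ = ∈-++⁺ˡ (∈-map⁺ (f c₁) x∈)
  ∈-copies⁺ c₂ x∈ = ∈-++⁺ʳ (map (f c₁) (xs c₁)) (∈-++⁺ˡ (∈-map⁺ (f c₂) x∈))
  ∈-copies⁺ c₃ x∈ = ∈-++⁺ʳ (map (f c₁) (xs c₁)) (∈-++⁺ʳ (map (f c₂) (xs c₂)) (∈-map⁺ (f c₃) x∈))

  ∈-copies⁻ : ∀ {y} → y ∈ copies f xs → Σ Copy λ r → ∃ λ x → x ∈ xs r × y ≡ f r x
  ∈-copies⁻ y∈ with ∈-++⁻ (map (f c₁) (xs c₁)) y∈
  ... | inj₁ y∈₁ = c₁ , ∈-map⁻ (f c₁) y∈₁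
  ... | inj₂ y∈₂₃ with ∈-++⁻ (map (f c₂) (xs c₂)) y∈₂₃
  ...   | inj₁ y∈₂ = c₂ , ∈-map⁻ (f c₂) y∈₂
  ...   | inj₂ y∈₃ = c₃ , ∈-map⁻ (f c₃) y∈₃

  copies-unique : (∀ {r s x x′} → f r x ≡ f s x′ → r ≡ s × x ≡ x′) → (∀ r → Unique (xs r)) →
                  Unique (copies f xs)
  copies-unique f-injective unique =
    ++⁺ (map⁺ (proj₂ ∘ f-injective) (unique c₁))
        (++⁺ (map⁺ (proj₂ ∘ f-injective) (unique c₂)) (map⁺ (proj₂ ∘ f-injective) (unique c₃)) (disjoint λ ()))
        λ (y∈₁ , y∈₂₃) → [ (λ y∈₂ → disjoint (λ ()) (y∈₁ , y∈₂))
                         , (λ y∈₃ → disjoint (λ ()) (y∈₁ , y∈₃))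
                         ]′ (∈-++⁻ (map (f c₂) (xs c₂)) y∈₂₃)
    where
    disjoint : ∀ {r s y} → r ≢ s → ¬ (y ∈ map (f r) (xs r) × y ∈ map (f s) (xs s))
    disjoint r≢s (y∈r , y∈s) with ∈-map⁻ (f _) y∈r | ∈-map⁻ (f _) y∈s
    ... | _ , _ , refl | _ , _ , eq = r≢s (proj₁ (f-injective eq))

count-copies : ∀ t (f : Copy → ℕ → ℕ) xs → count t (copies f xs) ≡ Σᶜ (λ r → count (t ∘ f r) (xs r))
count-copies t f xs = begin
  count t (copies f xs)                       ≡⟨ count-++ t (map (f c₁) (xs c₁)) _ ⟩
  count t xs₁ + count t (xs₂ ++ xs₃)          ≡⟨ cong (count t xs₁ +_) (count-++ t xs₂ xs₃) ⟩
  count t xs₁ + (count t xs₂ + count t xs₃)   ≡⟨ sym (+-assoc (count t xs₁) (count t xs₂) (count t xs₃)) ⟩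
  Σᶜ (λ r → count t (map (f r) (xs r)))       ≡⟨ Σᶜ-cong (λ r → count-map t (f r) (xs r)) ⟩
  Σᶜ (λ r → count (t ∘ f r) (xs r))           ∎
  where
  open ≡-Reasoning
  xs₁ xs₂ xs₃ : List ℕ
  xs₁ = map (f c₁) (xs c₁)
  xs₂ = map (f c₂) (xs c₂)
  xs₃ = map (f c₃) (xs c₃)

rank : Copy → ℕ
rank c₁ = 0
rank c₂ = 1
rank c₃ = 2

-- 'step' labels v in copy r by code r v, except at the identified corners (see 'canonical' below).
code : Copy → ℕ → ℕ
code c₁ v = 3 * v
code c₂ v = 3 * v + 1
code c₃ v = 3 * v + 2

code≡rank+v*3 : ∀ r v → code r v ≡ rank r + v * 3
code≡rank+v*3 c₁ v = *-comm 3 v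
code≡rank+v*3 c₂ v = trans (+-comm (3 * v) 1) (cong (1 +_) (*-comm 3 v))
code≡rank+v*3 c₃ v = trans (+-comm (3 * v) 2) (cong (2 +_) (*-comm 3 v))

code%3≡rank : ∀ r v → code r v % 3 ≡ rank r
code%3≡rank r v = trans (cong (_% 3) (code≡rank+v*3 r v)) (trans ([m+kn]%n≡m%n (rank r) v 3) (m<n⇒m%n≡m (rank<3 r)))
  where
  rank<3 : ∀ r → rank r < 3
  rank<3 c₁ = s≤s z≤n
  rank<3 c₂ = s≤s (s≤s z≤n)
  rank<3 c₃ = s≤s (s≤s (s≤s z≤n))

rank-injective : ∀ {r s} → rank r ≡ rank s → r ≡ s
rank-injective {c₁} {c₁} _ = refl
rank-injective {c₂} {c₂} _ = refl
rank-injective {c₃} {c₃} _ = refl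
rank-injective {c₁} {c₂} ()
rank-injective {c₁} {c₃} ()
rank-injective {c₂} {c₁} ()
rank-injective {c₂} {c₃} ()
rank-injective {c₃} {c₁} ()
rank-injective {c₃} {c₂} ()

code-injective : ∀ {r s v u} → code r v ≡ code s u → r ≡ s × v ≡ u
code-injective {r} {s} {v} {u} eq
  with rank-injective (trans (sym (code%3≡rank r v)) (trans (cong (_% 3) eq) (code%3≡rank s u)))
... | refl = refl , *-cancelʳ-≡ v u 3 (+-cancelˡ-≡ (rank r) (v * 3) (u * 3)
                                      (trans (sym (code≡rank+v*3 r v)) (trans eq (code≡rank+v*3 r u))))

≡⇒≡ᵇ-true : ∀ {m n} → m ≡ n → (m ≡ᵇ n) ≡ true
≡⇒≡ᵇ-true {m} {n} = dec-true (m ≟ n)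

≢⇒≡ᵇ-false : ∀ {m n} → m ≢ n → (m ≡ᵇ n) ≡ false
≢⇒≡ᵇ-false {m} {n} = dec-false (m ≟ n)

≡ᵇ-true⇒≡ : ∀ m n → (m ≡ᵇ n) ≡ true → m ≡ n
≡ᵇ-true⇒≡ m n eq = ≡ᵇ⇒≡ m n (subst T (sym eq) tt)

record Enumeration (G : Graph) : Set where
  field
    inner    : List ℕ
    unique   : Unique (A G ∷ B G ∷ C G ∷ inner)
    complete : ∀ {v} → v ∈ verts G → v ∈ A G ∷ B G ∷ C G ∷ inner
    sound    : ∀ {v} → v ∈ A G ∷ B G ∷ C G ∷ inner → v ∈ verts G

record Profile (G : Graph) (admissible : Pattern → Bool) (size : Pattern → ℕ) : Set where
  field
    admissible-outmost : ∀ {I} → IndependentSet G I → T (admissible (outmost G I))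
    length-bounded     : ∀ {I} → IndependentSet G I → length I ≤ size (outmost G I)
    attained           : ∀ p → T (admissible p) →
                         Σ (List ℕ) λ I → IndependentSet G I × outmost G I ≡ p × length I ≡ size p

anyPattern : Pattern → Bool
anyPattern _ = true

-- size′ p = max over junction patterns q of (Σᶜ λ r → size (copyPattern r p q)) − weight q, attained at junction p.
record Recurrence (admissible : Pattern → Bool) (size size′ : Pattern → ℕ) : Set where
  field
    bound               : ∀ p q → (∀ r → T (admissible (copyPattern r p q))) →
                          Σᶜ (λ r → size (copyPattern r p q)) ≤ size′ p + weight q
    junction            : Pattern → Pattern
    junction-admissible : ∀ p r → T (admissible (copyPattern r p (junction p)))
    junction-tight      : ∀ p → Σᶜ (λ r → size (copyPattern r p (junction p))) ≡ size′ p + weight (junction p)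

module Step {G : Graph} (E : Enumeration G) where

  open Enumeration E

  vertices : List ℕ
  vertices = A G ∷ B G ∷ C G ∷ inner

  A∈ : A G ∈ vertices
  A∈ = here refl

  B∈ : B G ∈ vertices
  B∈ = there (here refl)

  C∈ : C G ∈ vertices
  C∈ = there (there (here refl))

  copy : Copy → ℕ → ℕ
  copy c₁ = copy1 G
  copy c₂ = copy2 G
  copy c₃ = copy3 G

  corner : Copy → ℕ
  corner c₁ = A G
  corner c₂ = B G
  corner c₃ = C G

  after : Copy → List ℕ
  after c₁ = B G ∷ C G ∷ inner
  after c₂ = C G ∷ inner
  after c₃ = inner

  corner-∉-after : ∀ r → corner r ∉ after r
  corner-∉-after r with unique
  corner-∉-after c₁ | A-fresh ∷ _          = All¬⇒¬Any A-fresh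
  corner-∉-after c₂ | _ ∷ B-fresh ∷ _      = All¬⇒¬Any B-fresh
  corner-∉-after c₃ | _ ∷ _ ∷ C-fresh ∷ _  = All¬⇒¬Any C-fresh

  after-unique : ∀ r → Unique (after r)
  after-unique r with unique
  after-unique c₁ | _ ∷ u           = u
  after-unique c₂ | _ ∷ _ ∷ u       = u
  after-unique c₃ | _ ∷ _ ∷ _ ∷ u   = u

  after⊆vertices : ∀ r {v} → v ∈ after r → v ∈ vertices
  after⊆vertices c₁ = there
  after⊆vertices c₂ = there ∘ there
  after⊆vertices c₃ = there ∘ there ∘ there

  ≢-corner : ∀ r {v} → v ∈ after r → v ≢ corner r
  ≢-corner r v∈ refl = corner-∉-after r v∈

  copy≡code : ∀ r {v} → v ∈ corner r ∷ after r → copy r v ≡ code r v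
  copy≡code c₁ _ = refl
  copy≡code c₂ v∈ rewrite ≢⇒≡ᵇ-false (≢-corner c₁ v∈) = refl
  copy≡code c₃ v∈ rewrite ≢⇒≡ᵇ-false (≢-corner c₁ (there v∈)) | ≢⇒≡ᵇ-false (≢-corner c₂ v∈) = refl

  copy₂-A : copy c₂ (A G) ≡ copy c₁ (B G)
  copy₂-A rewrite ≡⇒≡ᵇ-true {A G} refl = refl

  copy₃-A : copy c₃ (A G) ≡ copy c₁ (C G)
  copy₃-A rewrite ≡⇒≡ᵇ-true {A G} refl = refl

  copy₃-B : copy c₃ (B G) ≡ copy c₂ (C G)
  copy₃-B rewrite ≢⇒≡ᵇ-false (≢-corner c₁ (here refl)) | ≡⇒≡ᵇ-true {B G} refl = refl

  -- The copy and vertex whose code is the label that 'step' gives to v in copy r.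
  canonical : Copy → ℕ → Copy × ℕ
  canonical c₁ v = c₁ , v
  canonical c₂ v = if v ≡ᵇ A G then (c₁ , B G) else (c₂ , v)
  canonical c₃ v = if v ≡ᵇ A G then (c₁ , C G) else (if v ≡ᵇ B G then (c₂ , C G) else (c₃ , v))

  copy≡code-canonical : ∀ r v → copy r v ≡ uncurry code (canonical r v)
  copy≡code-canonical c₁ v = refl
  copy≡code-canonical c₂ v with v ≡ᵇ A G
  ... | true  = refl
  ... | false = refl
  copy≡code-canonical c₃ v with v ≡ᵇ A G
  ... | true  = refl
  ... | false with v ≡ᵇ B G
  ...   | true  = copy≡code c₂ (there (here refl))
  ...   | false = refl

  canonical-injective : ∀ {r s v u} → copy r v ≡ copy s u → canonical r v ≡ canonical s u
  canonical-injective {r} {s} {v} {u} eq =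
    code-pair-injective (trans (sym (copy≡code-canonical r v)) (trans eq (copy≡code-canonical s u)))
    where
    code-pair-injective : ∀ {p p′} → uncurry code p ≡ uncurry code p′ → p ≡ p′
    code-pair-injective {r′ , v′} {s′ , u′} eq′ with code-injective {r′} {s′} {v′} {u′} eq′
    ... | refl , refl = refl

  record Consistent (J : Copy → List ℕ) : Set where
    field
      at-B₁ : A G ∈ J c₂ ⇔ B G ∈ J c₁
      at-C₁ : A G ∈ J c₃ ⇔ C G ∈ J c₁
      at-C₂ : B G ∈ J c₃ ⇔ C G ∈ J c₂

  InCopy : (Copy → List ℕ) → Copy × ℕ → Set
  InCopy J (s , u) = u ∈ J s

  ∈⇔InCopy-canonical : ∀ {J} → Consistent J → ∀ r v → v ∈ J r ⇔ InCopy J (canonical r v)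
  ∈⇔InCopy-canonical K c₁ v = ⇔-refl
  ∈⇔InCopy-canonical K c₂ v with v ≡ᵇ A G in v≡ᵇA
  ... | true with refl ← ≡ᵇ-true⇒≡ v (A G) v≡ᵇA = Consistent.at-B₁ K
  ... | false = ⇔-refl
  ∈⇔InCopy-canonical K c₃ v with v ≡ᵇ A G in v≡ᵇA
  ... | true with refl ← ≡ᵇ-true⇒≡ v (A G) v≡ᵇA = Consistent.at-C₁ K
  ... | false with v ≡ᵇ B G in v≡ᵇB
  ...   | true with refl ← ≡ᵇ-true⇒≡ v (B G) v≡ᵇB = Consistent.at-C₂ K
  ...   | false = ⇔-refl

  transport : ∀ {J} → Consistent J → ∀ {r s v u} → copy r v ≡ copy s u → v ∈ J r → u ∈ J s
  transport {J} K {r} {s} {v} {u} eq v∈ =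
    from (∈⇔InCopy-canonical K s u)
         (subst (InCopy J) (canonical-injective {r} {s} {v} {u} eq) (to (∈⇔InCopy-canonical K r v) v∈))

  stepVertices : List ℕ
  stepVertices = copy c₁ (A G) ∷ copy c₂ (B G) ∷ copy c₃ (C G) ∷ copies code after

  copy-∈-verts : ∀ r {v} → v ∈ verts G → copy r v ∈ verts (step G)
  copy-∈-verts = ∈-copies⁺ {f = copy} {xs = λ _ → verts G}

  after-∈ : ∀ r {v} → v ∈ after r → copy r v ∈ stepVertices
  after-∈ r v∈ = there (there (there (subst (_∈ copies code after) (sym (copy≡code r (there v∈)))
                                             (∈-copies⁺ {f = code} {xs = after} r v∈))))

  copy-∈-stepVertices : ∀ r {v} → v ∈ vertices → copy r v ∈ stepVertices
  copy-∈-stepVertices c₁ (here refl)                 = here refl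
  copy-∈-stepVertices c₁ (there v∈)                  = after-∈ c₁ v∈
  copy-∈-stepVertices c₂ (here refl)                 = subst (_∈ stepVertices) (sym copy₂-A) (after-∈ c₁ (here refl))
  copy-∈-stepVertices c₂ (there (here refl))         = there (here refl)
  copy-∈-stepVertices c₂ (there (there v∈))          = after-∈ c₂ v∈
  copy-∈-stepVertices c₃ (here refl)                 = subst (_∈ stepVertices) (sym copy₃-A) (after-∈ c₁ (there (here refl)))
  copy-∈-stepVertices c₃ (there (here refl))         = subst (_∈ stepVertices) (sym copy₃-B) (after-∈ c₂ (here refl))
  copy-∈-stepVertices c₃ (there (there (here refl))) = there (there (here refl))
  copy-∈-stepVertices c₃ (there (there (there v∈)))  = after-∈ c₃ v∈

  step-complete : ∀ {w} → w ∈ verts (step G) → w ∈ stepVertices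
  step-complete w∈ with ∈-copies⁻ {f = copy} {xs = λ _ → verts G} w∈
  ... | r , v , v∈ , refl = copy-∈-stepVertices r (complete v∈)

  step-sound : ∀ {w} → w ∈ stepVertices → w ∈ verts (step G)
  step-sound (here refl)                 = copy-∈-verts c₁ (sound A∈)
  step-sound (there (here refl))         = copy-∈-verts c₂ (sound B∈)
  step-sound (there (there (here refl))) = copy-∈-verts c₃ (sound C∈)
  step-sound (there (there (there w∈))) with ∈-copies⁻ {f = code} {xs = after} w∈
  ... | r , v , v∈ , refl =
    subst (_∈ verts (step G)) (copy≡code r (there v∈)) (copy-∈-verts r (sound (after⊆vertices r v∈)))

  corner-code-∉ : ∀ r → code r (corner r) ∉ copies code after
  corner-code-∉ r w∈ with ∈-copies⁻ {f = code} {xs = after} w∈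
  ... | s , v , v∈ , eq with code-injective {r} {s} {corner r} {v} eq
  ...   | refl , refl = corner-∉-after r v∈

  step-unique : Unique stepVertices
  step-unique = subst Unique heads
    ( (tag c₁ c₂ (λ ()) ∷ tag c₁ c₃ (λ ()) ∷ fresh c₁)
    ∷ (tag c₂ c₃ (λ ()) ∷ fresh c₂)
    ∷ fresh c₃
    ∷ copies-unique code-injective after-unique)
    where
    tag : ∀ r s → r ≢ s → code r (corner r) ≢ code s (corner s)
    tag r s r≢s = r≢s ∘ proj₁ ∘ code-injective {r} {s} {corner r} {corner s}
    fresh : ∀ r → All (code r (corner r) ≢_) (copies code after)
    fresh r = ¬Any⇒All¬ _ (corner-code-∉ r)
    heads : code c₁ (A G) ∷ code c₂ (B G) ∷ code c₃ (C G) ∷ copies code after ≡ stepVertices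
    heads = cong (code c₁ (A G) ∷_) (cong₂ _∷_ (sym (copy≡code c₂ (here refl)))
                                               (cong (_∷ copies code after) (sym (copy≡code c₃ (here refl)))))

  step-enumeration : Enumeration (step G)
  step-enumeration = record
    { inner = copies code after ; unique = step-unique ; complete = step-complete ; sound = step-sound }

  junctions : List ℕ → Pattern
  junctions I = copy c₁ (B G) ∈ᵇ I , copy c₁ (C G) ∈ᵇ I , copy c₂ (C G) ∈ᵇ I

  -- Each junction vertex is counted by two copies, so it must be added once more on the left.
  count-step : ∀ t → count t stepVertices + weight (t (copy c₁ (B G)) , t (copy c₁ (C G)) , t (copy c₂ (C G)))
                     ≡ Σᶜ (λ r → count (t ∘ copy r) vertices)
  count-step t = begin
      count t stepVertices + weight (t (copy c₁ (B G)) , t (copy c₁ (C G)) , t (copy c₂ (C G)))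
    ≡⟨ cong₂ (λ m n → a + (b + (c + m)) + n) inner-count (cong weight junction-bits) ⟩
      a + (b + (c + (Σᶜ X))) + (x + y + z)
    ≡⟨ rearrange a b c x y z (X c₁) (X c₂) (X c₃) ⟩
      (a + X c₁) + (x + (b + X c₂)) + (y + (z + (c + X c₃)))
    ∎
    where
    open ≡-Reasoning
    open +-*-Solver
    X : Copy → ℕ
    X r = count (t ∘ copy r) (after r)
    a b c x y z : ℕ
    a = bit (t (copy c₁ (A G)))
    b = bit (t (copy c₂ (B G)))
    c = bit (t (copy c₃ (C G)))
    x = bit (t (copy c₂ (A G)))
    y = bit (t (copy c₃ (A G)))
    z = bit (t (copy c₃ (B G)))
    inner-count : count t (copies code after) ≡ Σᶜ X
    inner-count = trans (count-copies t code after)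
                        (Σᶜ-cong λ r → count-cong (after r) λ v∈ → cong t (sym (copy≡code r (there v∈))))
    junction-bits : (t (copy c₁ (B G)) , t (copy c₁ (C G)) , t (copy c₂ (C G)))
                    ≡ (t (copy c₂ (A G)) , t (copy c₃ (A G)) , t (copy c₃ (B G)))
    junction-bits = pattern-≡ (cong t (sym copy₂-A)) (cong t (sym copy₃-A)) (cong t (sym copy₃-B))
    rearrange : ∀ a b c x y z X₁ X₂ X₃ →
      a + (b + (c + (X₁ + X₂ + X₃))) + (x + y + z) ≡ (a + X₁) + (x + (b + X₂)) + (y + (z + (c + X₃)))
    rearrange = solve 9 (λ a b c x y z X₁ X₂ X₃ →
      a :+ (b :+ (c :+ (X₁ :+ X₂ :+ X₃))) :+ (x :+ y :+ z)
        := (a :+ X₁) :+ (x :+ (b :+ X₂)) :+ (y :+ (z :+ (c :+ X₃)))) refl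

  adj-copy⁺ : ∀ r {u v} → Adj G u v → Adj (step G) (copy r u) (copy r v)
  adj-copy⁺ r (inj₁ uv∈) = inj₁ (∈-copies⁺ {f = λ r → mapEdge (copy r)} {xs = λ _ → edges G} r uv∈)
  adj-copy⁺ r (inj₂ vu∈) = inj₂ (∈-copies⁺ {f = λ r → mapEdge (copy r)} {xs = λ _ → edges G} r vu∈)

  adj-copy⁻ : ∀ {x y} → Adj (step G) x y → Σ Copy λ r → ∃₂ λ u v → Adj G u v × x ≡ copy r u × y ≡ copy r v
  adj-copy⁻ (inj₁ xy∈) with ∈-copies⁻ {f = λ r → mapEdge (copy r)} {xs = λ _ → edges G} xy∈
  ... | r , (u , v) , uv∈ , refl = r , u , v , inj₁ uv∈ , refl , refl
  adj-copy⁻ (inj₂ yx∈) with ∈-copies⁻ {f = λ r → mapEdge (copy r)} {xs = λ _ → edges G} yx∈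
  ... | r , (u , v) , uv∈ , refl = r , v , u , inj₂ uv∈ , refl , refl

  restrict : List ℕ → Copy → List ℕ
  restrict I r = filter (λ v → copy r v ∈? I) vertices

  restrict-independent : ∀ {I} → IndependentSet (step G) I → ∀ r → IndependentSet G (restrict I r)
  restrict-independent {I} indI r = record
    { unique  = filter⁺ (λ v → copy r v ∈? I) unique
    ; inVerts = All.tabulate (sound ∘ proj₁ ∘ ∈-filter⁻ (λ v → copy r v ∈? I))
    ; nonAdj  = λ u∈ v∈ → IndependentSet.nonAdj indI (proj₂ (∈-filter⁻ (λ v → copy r v ∈? I) u∈))
                                                     (proj₂ (∈-filter⁻ (λ v → copy r v ∈? I) v∈)) ∘ adj-copy⁺ r
    }

  ∈ᵇ-restrict : ∀ I r {v} → v ∈ vertices → v ∈ᵇ restrict I r ≡ copy r v ∈ᵇ I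
  ∈ᵇ-restrict I r v∈ =
    ∈ᵇ-cong (mk⇔ (proj₂ ∘ ∈-filter⁻ (λ v → copy r v ∈? I)) (∈-filter⁺ (λ v → copy r v ∈? I) v∈))

  outmost-restrict : ∀ I r → outmost G (restrict I r) ≡ copyPattern r (outmost (step G) I) (junctions I)
  outmost-restrict I c₁ = pattern-≡ (∈ᵇ-restrict I c₁ A∈) (∈ᵇ-restrict I c₁ B∈) (∈ᵇ-restrict I c₁ C∈)
  outmost-restrict I c₂ =
    pattern-≡ (trans (∈ᵇ-restrict I c₂ A∈) (cong (_∈ᵇ I) copy₂-A))
              (∈ᵇ-restrict I c₂ B∈)
              (∈ᵇ-restrict I c₂ C∈)
  outmost-restrict I c₃ =
    pattern-≡ (trans (∈ᵇ-restrict I c₃ A∈) (cong (_∈ᵇ I) copy₃-A))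
              (trans (∈ᵇ-restrict I c₃ B∈) (cong (_∈ᵇ I) copy₃-B))
              (∈ᵇ-restrict I c₃ C∈)

  length-restrict : ∀ {I} → IndependentSet (step G) I →
                    length I + weight (junctions I) ≡ Σᶜ (λ r → length (restrict I r))
  length-restrict {I} indI = begin
    length I + weight (junctions I)
      ≡⟨ cong (_+ weight (junctions I)) (length≡count-∈ᵇ (IndependentSet.unique indI) step-unique
                                          (step-complete ∘ All.lookup (IndependentSet.inVerts indI))) ⟩
    count (_∈ᵇ I) stepVertices + weight (junctions I)
      ≡⟨ count-step (_∈ᵇ I) ⟩
    Σᶜ (λ r → count (λ v → copy r v ∈ᵇ I) vertices)
      ≡⟨ Σᶜ-cong (λ r → sym (length-filter≡count (λ v → copy r v ∈? I) vertices)) ⟩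
    Σᶜ (λ r → length (restrict I r))
      ∎
    where open ≡-Reasoning

  glue : (Copy → List ℕ) → List ℕ
  glue J = deduplicate _≟_ (copies copy J)

  ∈-glue⁺ : ∀ {J} r {v} → v ∈ J r → copy r v ∈ glue J
  ∈-glue⁺ {J} r v∈ = to (deduplicate-∈⇔ _≟_) (∈-copies⁺ {f = copy} {xs = J} r v∈)

  ∈-glue⁻ : ∀ {J w} → w ∈ glue J → Σ Copy λ r → ∃ λ v → v ∈ J r × w ≡ copy r v
  ∈-glue⁻ {J} w∈ = ∈-copies⁻ {f = copy} {xs = J} (from (deduplicate-∈⇔ _≟_) w∈)

  copy-∈-glue⁻ : ∀ {J} → Consistent J → ∀ {r v} → copy r v ∈ glue J → v ∈ J r
  copy-∈-glue⁻ {J} K {r} {v} w∈ with ∈-glue⁻ {J} w∈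
  ... | s , u , u∈ , eq = transport K {s} {r} {u} {v} (sym eq) u∈

  glue-independent : ∀ {J} → Consistent J → (∀ r → IndependentSet G (J r)) → IndependentSet (step G) (glue J)
  glue-independent {J} K indJ = record
    { unique  = deduplicate-! (copies copy J)
    ; inVerts = All.tabulate glue⊆verts
    ; nonAdj  = nonAdj
    }
    where
    glue⊆verts : ∀ {w} → w ∈ glue J → w ∈ verts (step G)
    glue⊆verts w∈ with ∈-glue⁻ w∈
    ... | r , v , v∈ , refl = copy-∈-verts r (All.lookup (IndependentSet.inVerts (indJ r)) v∈)
    nonAdj : ∀ {x y} → x ∈ glue J → y ∈ glue J → ¬ Adj (step G) x y
    nonAdj x∈ y∈ adj with adj-copy⁻ adj
    ... | r , u , v , uv , refl , refl = IndependentSet.nonAdj (indJ r) (copy-∈-glue⁻ K x∈) (copy-∈-glue⁻ K y∈) uv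

  restrict-glue : ∀ {J} → Consistent J → (∀ r → IndependentSet G (J r)) → ∀ r → restrict (glue J) r ∼[ set ] J r
  restrict-glue {J} K indJ r = mk⇔
    (copy-∈-glue⁻ K ∘ proj₂ ∘ ∈-filter⁻ (λ v → copy r v ∈? glue J))
    (λ v∈ → ∈-filter⁺ (λ v → copy r v ∈? glue J) (complete (All.lookup (IndependentSet.inVerts (indJ r)) v∈))
                      (∈-glue⁺ {J} r v∈))

  consistent : ∀ {J p q} → (∀ r → outmost G (J r) ≡ copyPattern r p q) → Consistent J
  consistent {J} {_ , _ , _} {_ , _ , _} outmost-J = record
    { at-B₁ = ∈ᵇ-≡⇒⇔ (trans (cong proj₁ (outmost-J c₂)) (sym (cong (proj₁ ∘ proj₂) (outmost-J c₁))))
    ; at-C₁ = ∈ᵇ-≡⇒⇔ (trans (cong proj₁ (outmost-J c₃)) (sym (cong (proj₂ ∘ proj₂) (outmost-J c₁))))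
    ; at-C₂ = ∈ᵇ-≡⇒⇔ (trans (cong (proj₁ ∘ proj₂) (outmost-J c₃)) (sym (cong (proj₂ ∘ proj₂) (outmost-J c₂))))
    }

  gluing : ∀ {J p q} → (∀ r → IndependentSet G (J r)) → (∀ r → outmost G (J r) ≡ copyPattern r p q) →
           IndependentSet (step G) (glue J) × outmost (step G) (glue J) ≡ p
           × length (glue J) + weight q ≡ Σᶜ (λ r → length (J r))
  gluing {J} {p} {q} indJ outmost-J = indI , proj₁ recovered , length-glue
    where
    open ≡-Reasoning
    K : Consistent J
    K = consistent outmost-J
    indI : IndependentSet (step G) (glue J)
    indI = glue-independent K indJ
    restrict≈J : ∀ r → restrict (glue J) r ∼[ set ] J r
    restrict≈J = restrict-glue K indJ
    recovered : outmost (step G) (glue J) ≡ p × junctions (glue J) ≡ q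
    recovered = copyPattern-injective λ r →
      trans (sym (outmost-restrict (glue J) r)) (trans (outmost-cong G (restrict≈J r)) (outmost-J r))
    length-glue : length (glue J) + weight q ≡ Σᶜ (λ r → length (J r))
    length-glue = begin
      length (glue J) + weight q                    ≡⟨ cong (λ q → length (glue J) + weight q) (sym (proj₂ recovered)) ⟩
      length (glue J) + weight (junctions (glue J)) ≡⟨ length-restrict indI ⟩
      Σᶜ (λ r → length (restrict (glue J) r))       ≡⟨ Σᶜ-cong (λ r → length-cong-set
                                                         (IndependentSet.unique (restrict-independent indI r))
                                                         (IndependentSet.unique (indJ r)) (restrict≈J r)) ⟩
      Σᶜ (λ r → length (J r))                       ∎

  profile-step : ∀ {admissible size size′} → Profile G admissible size → Recurrence admissible size size′ →
                 Profile (step G) anyPattern size′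
  profile-step {admissible} {size} {size′} P R = record
    { admissible-outmost = λ _ → tt
    ; length-bounded     = bounded
    ; attained           = λ p _ → attain p
    }
    where
    open Profile P
    open Recurrence R

    bounded : ∀ {I} → IndependentSet (step G) I → length I ≤ size′ (outmost (step G) I)
    bounded {I} indI = +-cancelʳ-≤ (weight q) (length I) (size′ p) (begin
      length I + weight q                  ≡⟨ length-restrict indI ⟩
      Σᶜ (λ r → length (restrict I r))     ≤⟨ Σᶜ-mono-≤ (λ r → subst (λ s → length (restrict I r) ≤ size s) (outmost-restrict I r)
                                                                     (length-bounded (restrict-independent indI r))) ⟩
      Σᶜ (λ r → size (copyPattern r p q))  ≤⟨ bound p q (λ r → subst (T ∘ admissible) (outmost-restrict I r)
                                                                     (admissible-outmost (restrict-independent indI r))) ⟩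
      size′ p + weight q                   ∎)
      where
      open ≤-Reasoning
      p q : Pattern
      p = outmost (step G) I
      q = junctions I

    attain : ∀ p → Σ (List ℕ) λ I → IndependentSet (step G) I × outmost (step G) I ≡ p × length I ≡ size′ p
    attain p = glue J , proj₁ glued , proj₁ (proj₂ glued) , +-cancelʳ-≡ (weight q) (length (glue J)) (size′ p) (begin
      length (glue J) + weight q           ≡⟨ proj₂ (proj₂ glued) ⟩
      Σᶜ (λ r → length (J r))              ≡⟨ Σᶜ-cong (λ r → proj₂ (proj₂ (proj₂ (piece r)))) ⟩
      Σᶜ (λ r → size (copyPattern r p q))  ≡⟨ junction-tight p ⟩
      size′ p + weight q                   ∎)
      where
      open ≡-Reasoning
      q : Pattern
      q = junction p
      piece : ∀ r → Σ (List ℕ) λ J → IndependentSet G J × outmost G J ≡ copyPattern r p q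
                                   × length J ≡ size (copyPattern r p q)
      piece r = attained (copyPattern r p q) (junction-admissible p r)
      J : Copy → List ℕ
      J r = proj₁ (piece r)
      glued : IndependentSet (step G) (glue J) × outmost (step G) (glue J) ≡ p
              × length (glue J) + weight q ≡ Σᶜ (λ r → length (J r))
      glued = gluing {J} (λ r → proj₁ (proj₂ (piece r))) (λ r → proj₁ (proj₂ (proj₂ (piece r))))


bonus : ℕ → ℕ
bonus 0 = 0
bonus 1 = 1
bonus 2 = 1
bonus _ = 2

bonus-≤1 : ∀ {k} → k ≤ 1 → bonus k ≡ k
bonus-≤1 z≤n       = refl
bonus-≤1 (s≤s z≤n) = refl

gasket : ℕ → Pattern → ℕ
gasket m p = m + bonus (weight p)

atMostOne : Pattern → Bool
atMostOne p = weight p ≤ᵇ 1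

bonus-bound : ∀ p q → Σᶜ (λ r → bonus (weight (copyPattern r p q))) ≤ 1 + bonus (weight p) + weight q
bonus-bound p q = ≤ᵇ⇒≤ _ _ (decide₂ check tt p q)
  where
  check : Pattern → Pattern → Bool
  check p q = Σᶜ (λ r → bonus (weight (copyPattern r p q))) ≤ᵇ 1 + bonus (weight p) + weight q

-- Select the junction vertex opposite the single chosen corner (any one if no corner is chosen),
-- and no junction vertex if two or more corners are chosen.
junction : Pattern → Pattern
junction (false , false , false) = false , false , true
junction (true  , false , false) = false , false , true
junction (false , true  , false) = false , true  , false
junction (false , false , true ) = true  , false , false
junction _                       = false , false , false

bonus-tight : ∀ p → Σᶜ (λ r → bonus (weight (copyPattern r p (junction p)))) ≡ 1 + bonus (weight p) + weight (junction p)
bonus-tight p = ≡ᵇ⇒≡ _ _ (decide check tt p)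
  where
  check : Pattern → Bool
  check p = Σᶜ (λ r → bonus (weight (copyPattern r p (junction p)))) ≡ᵇ 1 + bonus (weight p) + weight (junction p)

junction-atMostOne : ∀ p r → T (atMostOne (copyPattern r p (junction p)))
junction-atMostOne p c₁ = decide (λ p → atMostOne (copyPattern c₁ p (junction p))) tt p
junction-atMostOne p c₂ = decide (λ p → atMostOne (copyPattern c₂ p (junction p))) tt p
junction-atMostOne p c₃ = decide (λ p → atMostOne (copyPattern c₃ p (junction p))) tt p

gasket-recurrence : ∀ {admissible} m → (∀ p r → T (admissible (copyPattern r p (junction p)))) →
                    Recurrence admissible (gasket m) (gasket (3 * m + 1))
gasket-recurrence m junction-admissible = record
  { bound               = λ p q _ → begin
      Σᶜ (λ r → gasket m (copyPattern r p q))                 ≡⟨ Σᶜ-shift (λ r → bonus (weight (copyPattern r p q))) ⟩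
      3 * m + Σᶜ (λ r → bonus (weight (copyPattern r p q)))  ≤⟨ +-monoʳ-≤ (3 * m) (bonus-bound p q) ⟩
      3 * m + (1 + bonus (weight p) + weight q)              ≡⟨ regroup (bonus (weight p)) (weight q) ⟩
      gasket (3 * m + 1) p + weight q                        ∎
  ; junction            = junction
  ; junction-admissible = junction-admissible
  ; junction-tight      = λ p → trans (Σᶜ-shift (λ r → bonus (weight (copyPattern r p (junction p)))))
                                      (trans (cong (3 * m +_) (bonus-tight p)) (regroup (bonus (weight p)) (weight (junction p))))
  }
  where
  open ≤-Reasoning
  open +-*-Solver
  Σᶜ-shift : ∀ f → Σᶜ (λ r → m + f r) ≡ 3 * m + Σᶜ f
  Σᶜ-shift f = solve 4 (λ m x y z → (m :+ x) :+ (m :+ y) :+ (m :+ z) := con 3 :* m :+ (x :+ y :+ z))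
                       refl m (f c₁) (f c₂) (f c₃)
  regroup : ∀ x y → 3 * m + (1 + x + y) ≡ 3 * m + 1 + x + y
  regroup x y = solve 3 (λ m x y → con 3 :* m :+ (con 1 :+ x :+ y) := con 3 :* m :+ con 1 :+ x :+ y) refl m x y

triangle-enumeration : Enumeration triangle
triangle-enumeration = record
  { inner    = []
  ; unique   = ((λ ()) ∷ (λ ()) ∷ []) ∷ ((λ ()) ∷ []) ∷ [] ∷ []
  ; complete = λ v∈ → v∈
  ; sound    = λ v∈ → v∈
  }

triangle-irreflexive : All (uncurry _≢_) (edges triangle)
triangle-irreflexive = (λ ()) ∷ (λ ()) ∷ (λ ()) ∷ []

triangle-loopless : ∀ {v} → ¬ Adj triangle v v
triangle-loopless (inj₁ vv∈) = All.lookup triangle-irreflexive vv∈ refl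
triangle-loopless (inj₂ vv∈) = All.lookup triangle-irreflexive vv∈ refl

triangle-singleton : ∀ {v} → v ∈ verts triangle → IndependentSet triangle (v ∷ [])
triangle-singleton v∈ = record
  { unique  = [] ∷ []
  ; inVerts = v∈ ∷ []
  ; nonAdj  = λ { (here refl) (here refl) → triangle-loopless }
  }

triangle-atMostOne : ∀ {J} → IndependentSet triangle J → T (atMostOne (outmost triangle J))
triangle-atMostOne {J} indJ with 0 ∈? J | 1 ∈? J | 2 ∈? J
... | yes 0∈ | yes 1∈ | _      = ⊥-elim (IndependentSet.nonAdj indJ 0∈ 1∈ (inj₁ (here refl)))
... | _      | yes 1∈ | yes 2∈ = ⊥-elim (IndependentSet.nonAdj indJ 1∈ 2∈ (inj₁ (there (here refl))))
... | yes 0∈ | _      | yes 2∈ = ⊥-elim (IndependentSet.nonAdj indJ 0∈ 2∈ (inj₁ (there (there (here refl)))))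
... | yes _  | no _   | no _   = tt
... | no _   | yes _  | no _   = tt
... | no _   | no _   | yes _  = tt
... | no _   | no _   | no _   = tt

triangle-length : ∀ {J} → IndependentSet triangle J → length J ≡ weight (outmost triangle J)
triangle-length {J} indJ =
  trans (length≡count-∈ᵇ (IndependentSet.unique indJ) (Enumeration.unique triangle-enumeration)
                         (All.lookup (IndependentSet.inVerts indJ)))
        (count-outmost triangle J)

triangle-profile : Profile triangle atMostOne (gasket 0)
triangle-profile = record
  { admissible-outmost = triangle-atMostOne
  ; length-bounded     = λ indJ → ≤-reflexive (trans (triangle-length indJ)
                                                      (sym (bonus-≤1 (≤ᵇ⇒≤ _ 1 (triangle-atMostOne indJ)))))
  ; attained           = attained
  }
  where
  attained : ∀ p → T (atMostOne p) →
             Σ (List ℕ) λ J → IndependentSet triangle J × outmost triangle J ≡ p × length J ≡ gasket 0 p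
  attained (false , false , false) _ = [] , record { unique = [] ; inVerts = [] ; nonAdj = λ () } , refl , refl
  attained (true  , false , false) _ = 0 ∷ [] , triangle-singleton (here refl) , refl , refl
  attained (false , true  , false) _ = 1 ∷ [] , triangle-singleton (there (here refl)) , refl , refl
  attained (false , false , true ) _ = 2 ∷ [] , triangle-singleton (there (there (here refl))) , refl , refl
  attained (true  , true  , _    ) ()
  attained (true  , false , true ) ()
  attained (false , true  , true ) ()

𝒮-enumeration : ∀ n → Enumeration (𝒮 (suc n))
𝒮-enumeration zero    = triangle-enumeration
𝒮-enumeration (suc n) = Step.step-enumeration (𝒮-enumeration n)

𝒮-profile : ∀ n → ∃ λ m → Profile (𝒮 (2 + n)) anyPattern (gasket m)
𝒮-profile zero = 1 , Step.profile-step triangle-enumeration triangle-profile (gasket-recurrence 0 junction-atMostOne)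
𝒮-profile (suc n) with 𝒮-profile n
... | m , P = 3 * m + 1 , Step.profile-step (𝒮-enumeration (suc n)) P (gasket-recurrence m (λ _ _ → tt))

gasket-isAlpha : ∀ {G m} → Profile G anyPattern (gasket m) → ∀ p → IsAlpha G (weight p) (gasket m p)
gasket-isAlpha {G} {m} P p with Profile.attained P p tt
... | I , indI , outmost-I , length-I =
  (I , indI , trans (outmostCount≡weight G I) (cong weight outmost-I) , length-I) ,
  λ J indJ count-J → subst (λ k → length J ≤ m + bonus k) (trans (sym (outmostCount≡weight G J)) count-J)
                           (Profile.length-bounded P indJ)

mainTheorem9 : ∀ n → 2 ≤ n →
    ∃ λ m → IsAlpha (𝒮 n) 0 m × IsAlpha (𝒮 n) 1 (m + 1)
          × IsAlpha (𝒮 n) 2 (m + 1) × IsAlpha (𝒮 n) 3 (m + 2)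
mainTheorem9 (suc (suc n)) (s≤s (s≤s _)) with 𝒮-profile n
... | m , P = m , subst (IsAlpha (𝒮 (2 + n)) 0) (+-identityʳ m) (gasket-isAlpha P (false , false , false))
                , gasket-isAlpha P (true , false , false) , gasket-isAlpha P (true , true , false)
                , gasket-isAlpha P (true , true , true)
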